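{- Define integer sequences $(a_n)_{n\ge 0}$ and $(b_n)_{n\ge 0}$ by $$a_0=0,\quad a_1=1,\quad a_n=4a_{n-1}-a_{n-2}+1\ (n\ge 2),$$ $$b_0=-1,\quad b_1=1,\quad b_n=4b_{n-1}-b_{n-2}+3\ (n\ge 2).$$ Then for every integer $n\ge 1$, $b_n$ is a positive integer and $$\frac{1}{b_n}\sum_{k=1}^{b_n}\frac{k(k+1)}{2}=\frac{a_n(a_n+1)}{2},$$ i.e. the average of the first $b_n$ triangular numbers $1,3,6,\dots$ is the $a_n$-th triangular number.
   Context: The $m$-th triangular number is $m(m+1)/2$. The first values are $a_n: 0,1,5,20,76,285,\dots$ and $b_n: -1,1,8,34,131,493,\dots$. -}

module Defs where

open import Data.Nat using (ℕ; zero; suc)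
open import Data.Integer using (ℤ; +_; -[1+_]) renaming (_+_ to _+ℤ_; _*_ to _*ℤ_; _-_ to _-ℤ_)
open import Data.Rational using (ℚ; 0ℚ; _/_) renaming (_+_ to _+ℚ_)

a : ℕ → ℤ
a zero = + 0
a (suc zero) = + 1
a (suc (suc n)) = (+ 4 *ℤ a (suc n)) -ℤ a n +ℤ + 1

b : ℕ → ℤ
b zero = -[1+ 0 ]
b (suc zero) = + 1
b (suc (suc n)) = (+ 4 *ℤ b (suc n)) -ℤ b n +ℤ + 3

tri : ℤ → ℚ
tri x = (x *ℤ (x +ℤ + 1)) / 2

sumTri : ℕ → ℚ
sumTri zero = 0ℚ
sumTri (suc m) = sumTri m +ℚ tri (+ suc m)

{-# OPTIONS --safe #-}
-- The first B triangular numbers sum to B(B+1)(B+2)/6, so the claim is (b + 1)(b + 2) = 3a(a + 1)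
-- for a = aₙ, b = bₙ.  One has bₙ₊₁ = 2aₙ₊₁ − aₙ − 1, and with x = aₙ₊₁, y = aₙ this becomes
-- (2x − y)(2x − y + 1) = 3x(x + 1) + (x² − 4xy + y² − x − y).  The last term vanishes along the
-- sequence: the conic x² − 4xy + y² − x − y = 0 contains (1, 0) and is mapped to itself by the
-- Vieta involution (x, y) ↦ (4x − y + 1, x), which is exactly the step of the recurrence for a.
-- Positivity: a increases strictly from a₀ = 0, so bₙ₊₁ = aₙ₊₁ + (aₙ₊₁ − aₙ) − 1 ≥ 1.
module Submission where

open import Defs
open import Data.Nat using (ℕ; zero; suc; _≥_; s≤s)
open import Data.Integer using (ℤ; +_; 0ℤ)
  renaming (_+_ to _+ℤ_; _*_ to _*ℤ_; _-_ to _-ℤ_)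
open import Data.Integer.Properties using (+-identityʳ)
open import Data.Integer.Tactic.RingSolver using (solve-∀)
open import Data.Rational using (_/_; _*_; fromℚᵘ; toℚᵘ) renaming (_+_ to _+ℚ_)
open import Data.Rational.Properties
  using (toℚᵘ-injective; toℚᵘ-fromℚᵘ; fromℚᵘ-cong; toℚᵘ-homo-+; toℚᵘ-homo-*)
open import Data.Rational.Unnormalised using (ℚᵘ; mkℚᵘ; *≡*)
  renaming (_+_ to _+ᵘ_; _*_ to _*ᵘ_)
open import Data.Rational.Unnormalised.Properties using (module ≃-Reasoning; +-cong; *-cong)
open import Data.Product using (∃-syntax; _×_; _,_)
open import Relation.Binary.PropositionalEquality
  using (_≡_; refl; sym; trans; cong; cong₂; module ≡-Reasoning)

conic : ℤ → ℤ → ℤ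
conic x y = x *ℤ x -ℤ + 4 *ℤ x *ℤ y +ℤ y *ℤ y -ℤ x -ℤ y

conic-vieta : ∀ x y → conic (+ 4 *ℤ x -ℤ y +ℤ + 1) x ≡ conic x y
conic-vieta = expanded
  where
  -- solve-∀ does not unfold conic, so the identity is restated with conic expanded.
  expanded : ∀ x y → let x′ = + 4 *ℤ x -ℤ y +ℤ + 1 in
    x′ *ℤ x′ -ℤ + 4 *ℤ x′ *ℤ x +ℤ x *ℤ x -ℤ x′ -ℤ x ≡ x *ℤ x -ℤ + 4 *ℤ x *ℤ y +ℤ y *ℤ y -ℤ x -ℤ y
  expanded = solve-∀

conic-a : ∀ n → conic (a (suc n)) (a n) ≡ 0ℤ
conic-a zero    = refl
conic-a (suc n) = trans (conic-vieta (a (suc n)) (a n)) (conic-a n)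

b≡2a-a-1 : ∀ n → b (suc n) ≡ + 2 *ℤ a (suc n) -ℤ a n -ℤ + 1
b≡2a-a-1 zero          = refl
b≡2a-a-1 (suc zero)    = refl
b≡2a-a-1 (suc (suc n)) =
  trans (cong₂ (λ u v → + 4 *ℤ u -ℤ v +ℤ + 3) (b≡2a-a-1 (suc n)) (b≡2a-a-1 n))
        (shift (a (suc n)) (a n))
  where
  shift : ∀ x y → let x′ = + 4 *ℤ x -ℤ y +ℤ + 1 in
    + 4 *ℤ (+ 2 *ℤ x′ -ℤ x -ℤ + 1) -ℤ (+ 2 *ℤ x -ℤ y -ℤ + 1) +ℤ + 3
      ≡ + 2 *ℤ (+ 4 *ℤ x′ -ℤ x +ℤ + 1) -ℤ x′ -ℤ + 1
  shift = solve-∀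

[b+1][b+2]≡3a[a+1] : ∀ n → (b n +ℤ + 1) *ℤ (b n +ℤ + 2) ≡ + 3 *ℤ (a n *ℤ (a n +ℤ + 1))
[b+1][b+2]≡3a[a+1] zero    = refl
[b+1][b+2]≡3a[a+1] (suc n) = begin
  (b (suc n) +ℤ + 1) *ℤ (b (suc n) +ℤ + 2)
    ≡⟨ cong (λ c → (c +ℤ + 1) *ℤ (c +ℤ + 2)) (b≡2a-a-1 n) ⟩
  (+ 2 *ℤ x -ℤ y -ℤ + 1 +ℤ + 1) *ℤ (+ 2 *ℤ x -ℤ y -ℤ + 1 +ℤ + 2)
    ≡⟨ split x y ⟩
  + 3 *ℤ (x *ℤ (x +ℤ + 1)) +ℤ conic x y
    ≡⟨ cong (+ 3 *ℤ (x *ℤ (x +ℤ + 1)) +ℤ_) (conic-a n) ⟩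
  + 3 *ℤ (x *ℤ (x +ℤ + 1)) +ℤ 0ℤ
    ≡⟨ +-identityʳ _ ⟩
  + 3 *ℤ (x *ℤ (x +ℤ + 1))
    ∎
  where
  open ≡-Reasoning
  x = a (suc n)
  y = a n
  split : ∀ x y → (+ 2 *ℤ x -ℤ y -ℤ + 1 +ℤ + 1) *ℤ (+ 2 *ℤ x -ℤ y -ℤ + 1 +ℤ + 2)
    ≡ + 3 *ℤ (x *ℤ (x +ℤ + 1)) +ℤ (x *ℤ x -ℤ + 4 *ℤ x *ℤ y +ℤ y *ℤ y -ℤ x -ℤ y)
  split = solve-∀

a-increasing : ∀ n → ∃[ p ] ∃[ q ] (a n ≡ + p × a (suc n) ≡ + p +ℤ + suc q)
a-increasing zero = 0 , 0 , refl , refl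
a-increasing (suc n) with a-increasing n
... | p , q , aₙ≡p , aₙ₊₁≡p+1+q =
  _ , _ , aₙ₊₁≡p+1+q ,
  trans (cong₂ (λ u v → + 4 *ℤ u -ℤ v +ℤ + 1) aₙ₊₁≡p+1+q aₙ≡p) (step (+ p) (+ q))
  where
  step : ∀ p q → + 4 *ℤ (p +ℤ (+ 1 +ℤ q)) -ℤ p +ℤ + 1
    ≡ (p +ℤ (+ 1 +ℤ q)) +ℤ (+ 1 +ℤ (p +ℤ p +ℤ q +ℤ q +ℤ q +ℤ + 3))
  step = solve-∀

b-positive : ∀ n → ∃[ m ] b (suc n) ≡ + suc m
b-positive n with a-increasing n
... | p , q , aₙ≡p , aₙ₊₁≡p+1+q =
  _ , trans (b≡2a-a-1 n)
            (trans (cong₂ (λ u v → + 2 *ℤ u -ℤ v -ℤ + 1) aₙ₊₁≡p+1+q aₙ≡p) (step (+ p) (+ q)))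
  where
  step : ∀ p q → + 2 *ℤ (p +ℤ (+ 1 +ℤ q)) -ℤ p -ℤ + 1 ≡ + 1 +ℤ p +ℤ q +ℤ q
  step = solve-∀

fromℚᵘ-homo-+ : ∀ (x y : ℚᵘ) → fromℚᵘ (x +ᵘ y) ≡ fromℚᵘ x +ℚ fromℚᵘ y
fromℚᵘ-homo-+ x y = toℚᵘ-injective (begin
  toℚᵘ (fromℚᵘ (x +ᵘ y))              ≈⟨ toℚᵘ-fromℚᵘ (x +ᵘ y) ⟩
  x +ᵘ y                              ≈⟨ +-cong (toℚᵘ-fromℚᵘ x) (toℚᵘ-fromℚᵘ y) ⟨
  toℚᵘ (fromℚᵘ x) +ᵘ toℚᵘ (fromℚᵘ y)  ≈⟨ toℚᵘ-homo-+ (fromℚᵘ x) (fromℚᵘ y) ⟨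
  toℚᵘ (fromℚᵘ x +ℚ fromℚᵘ y)         ∎)
  where open ≃-Reasoning

fromℚᵘ-homo-* : ∀ (x y : ℚᵘ) → fromℚᵘ (x *ᵘ y) ≡ fromℚᵘ x * fromℚᵘ y
fromℚᵘ-homo-* x y = toℚᵘ-injective (begin
  toℚᵘ (fromℚᵘ (x *ᵘ y))              ≈⟨ toℚᵘ-fromℚᵘ (x *ᵘ y) ⟩
  x *ᵘ y                              ≈⟨ *-cong (toℚᵘ-fromℚᵘ x) (toℚᵘ-fromℚᵘ y) ⟨
  toℚᵘ (fromℚᵘ x) *ᵘ toℚᵘ (fromℚᵘ y)  ≈⟨ toℚᵘ-homo-* (fromℚᵘ x) (fromℚᵘ y) ⟨
  toℚᵘ (fromℚᵘ x * fromℚᵘ y)          ∎)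
  where open ≃-Reasoning

-- i / suc d unfolds to fromℚᵘ (mkℚᵘ i d), so identities between such fractions are
-- cross-multiplications in ℚᵘ.

p/6+q/2≡[p+3q]/6 : ∀ p q → p / 6 +ℚ q / 2 ≡ (p +ℤ + 3 *ℤ q) / 6
p/6+q/2≡[p+3q]/6 p q =
  trans (sym (fromℚᵘ-homo-+ (mkℚᵘ p 5) (mkℚᵘ q 1)))
        (fromℚᵘ-cong {mkℚᵘ p 5 +ᵘ mkℚᵘ q 1} {mkℚᵘ (p +ℤ + 3 *ℤ q) 5} (*≡* (cross p q)))
  where
  cross : ∀ p q → (p *ℤ + 2 +ℤ q *ℤ + 6) *ℤ + 6 ≡ (p +ℤ + 3 *ℤ q) *ℤ + 12
  cross = solve-∀

[3q]/6≡q/2 : ∀ q → (+ 3 *ℤ q) / 6 ≡ q / 2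
[3q]/6≡q/2 q = fromℚᵘ-cong {mkℚᵘ (+ 3 *ℤ q) 5} {mkℚᵘ q 1} (*≡* (cross q))
  where
  cross : ∀ q → (+ 3 *ℤ q) *ℤ + 2 ≡ q *ℤ + 6
  cross = solve-∀

1/n*[np/d]≡p/d : ∀ m d p → (+ 1 / suc m) * ((+ suc m *ℤ p) / suc d) ≡ p / suc d
1/n*[np/d]≡p/d m d p =
  trans (sym (fromℚᵘ-homo-* (mkℚᵘ (+ 1) m) (mkℚᵘ (+ suc m *ℤ p) d)))
        (fromℚᵘ-cong {mkℚᵘ (+ 1) m *ᵘ mkℚᵘ (+ suc m *ℤ p) d} {mkℚᵘ p d}
                     (*≡* (cross (+ suc m) (+ suc d) p)))
  where
  cross : ∀ n e p → (+ 1 *ℤ (n *ℤ p)) *ℤ e ≡ p *ℤ (n *ℤ e)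
  cross = solve-∀

sumTri≡[M[M+1][M+2]]/6 : ∀ M → sumTri M ≡ (+ M *ℤ ((+ M +ℤ + 1) *ℤ (+ M +ℤ + 2))) / 6
sumTri≡[M[M+1][M+2]]/6 zero    = refl
sumTri≡[M[M+1][M+2]]/6 (suc M) = begin
  sumTri M +ℚ tri (+ suc M)         ≡⟨ cong (_+ℚ tri (+ suc M)) (sumTri≡[M[M+1][M+2]]/6 M) ⟩
  s / 6 +ℚ t / 2                    ≡⟨ p/6+q/2≡[p+3q]/6 s t ⟩
  (s +ℤ + 3 *ℤ t) / 6               ≡⟨ cong (_/ 6) (closedForm-step (+ M)) ⟩
  (+ suc M *ℤ ((+ suc M +ℤ + 1) *ℤ (+ suc M +ℤ + 2))) / 6  ∎
  where
  open ≡-Reasoning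
  s = + M *ℤ ((+ M +ℤ + 1) *ℤ (+ M +ℤ + 2))
  t = + suc M *ℤ (+ suc M +ℤ + 1)
  -- + 1 +ℤ z rather than z +ℤ + 1, because + 1 +ℤ + M reduces to + suc M.
  closedForm-step : ∀ z → z *ℤ ((z +ℤ + 1) *ℤ (z +ℤ + 2)) +ℤ + 3 *ℤ ((+ 1 +ℤ z) *ℤ ((+ 1 +ℤ z) +ℤ + 1))
    ≡ (+ 1 +ℤ z) *ℤ (((+ 1 +ℤ z) +ℤ + 1) *ℤ ((+ 1 +ℤ z) +ℤ + 2))
  closedForm-step = solve-∀

mean-sumTri : ∀ m → (+ 1 / suc m) * sumTri (suc m) ≡ ((+ suc m +ℤ + 1) *ℤ (+ suc m +ℤ + 2)) / 6
mean-sumTri m =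
  trans (cong ((+ 1 / suc m) *_) (sumTri≡[M[M+1][M+2]]/6 (suc m))) (1/n*[np/d]≡p/d m 5 ((+ suc m +ℤ + 1) *ℤ (+ suc m +ℤ + 2)))

mainTheorem1 : ∀ (n : ℕ) → n ≥ 1 →
    ∃[ m ] (b n ≡ + suc m × (+ 1 / suc m) * sumTri (suc m) ≡ tri (a n))
mainTheorem1 (suc n) (s≤s _) with b-positive n
... | m , bₙ≡1+m = m , bₙ≡1+m , (begin
  (+ 1 / suc m) * sumTri (suc m)
    ≡⟨ mean-sumTri m ⟩
  ((+ suc m +ℤ + 1) *ℤ (+ suc m +ℤ + 2)) / 6
    ≡⟨ cong (λ c → ((c +ℤ + 1) *ℤ (c +ℤ + 2)) / 6) bₙ≡1+m ⟨
  ((b (suc n) +ℤ + 1) *ℤ (b (suc n) +ℤ + 2)) / 6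
    ≡⟨ cong (_/ 6) ([b+1][b+2]≡3a[a+1] (suc n)) ⟩
  (+ 3 *ℤ (a (suc n) *ℤ (a (suc n) +ℤ + 1))) / 6
    ≡⟨ [3q]/6≡q/2 (a (suc n) *ℤ (a (suc n) +ℤ + 1)) ⟩
  tri (a (suc n))
    ∎)
  where open ≡-Reasoning
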